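{- If $G$ is a bipartite finite simple graph of order $n$, then $\chi_{md}(G\circ K_1)=\left\lceil \frac{n}{2}\right\rceil+1$.
   Context: The corona $G\circ K_1$ is obtained from $G$ by attaching to each vertex of $G$ one new pendant vertex adjacent only to it. For a vertex $v$, $N[v]=N(v)\cup\{v\}$; $v$ dominates exactly the vertices of $N[v]$. A majority dominator coloring of a graph $H$ is a proper vertex coloring such that for every vertex $v$ there is a color class $C$ with $|N[v]\cap C|\geq |C|/2$. $\chi_{md}(H)$ is the minimum number of color classes in a majority dominator coloring of $H$. -}

module Defs where

open import Data.Nat using (ℕ; zero; suc; _+_; _*_; _≤_; _<_)
open import Data.Fin using (Fin; zero; suc; splitAt; _≟_)
open import Data.Bool using (Bool; true; false; _∧_; _∨_)
open import Data.Sum using (_⊎_; inj₁; inj₂)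
open import Data.Product using (Σ; _×_; ∃)
open import Relation.Nullary using (¬_)
open import Relation.Nullary.Decidable using (⌊_⌋)
open import Relation.Binary.PropositionalEquality using (_≡_; _≢_)
open import Function.Definitions using (Surjective)

record SimpleGraph (n : ℕ) : Set where
  field
    adj    : Fin n → Fin n → Bool
    sym    : ∀ u v → adj u v ≡ adj v u
    irrefl : ∀ v → adj v v ≡ false
open SimpleGraph public

IsBipartite : ∀ {n} → SimpleGraph n → Set
IsBipartite {n} G =
  Σ (Fin n → Bool) λ side → ∀ u v → adj G u v ≡ true → side u ≢ side v

boolToℕ : Bool → ℕ
boolToℕ true  = 1
boolToℕ false = 0

count : ∀ {m} → (Fin m → Bool) → ℕ
count {zero}  p = 0
count {suc m} p = boolToℕ (p zero) + count (λ i → p (suc i))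

_==_ : ∀ {m} → Fin m → Fin m → Bool
i == j = ⌊ i ≟ j ⌋

-- Adjacency of the corona G ∘ K₁ on vertex set Fin (n + n):
-- vertices splitAt n to inj₁ i are the original vertices of G, those
-- splitting to inj₂ i are the pendant vertices, pendant i adjacent only to i.
coronaAdj' : ∀ {n} → SimpleGraph n → Fin n ⊎ Fin n → Fin n ⊎ Fin n → Bool
coronaAdj' G (inj₁ a) (inj₁ b) = adj G a b
coronaAdj' G (inj₁ a) (inj₂ b) = a == b
coronaAdj' G (inj₂ a) (inj₁ b) = a == b
coronaAdj' G (inj₂ a) (inj₂ b) = false

coronaAdj : ∀ {n} → SimpleGraph n → Fin (n + n) → Fin (n + n) → Bool
coronaAdj {n} G u v = coronaAdj' G (splitAt n u) (splitAt n v)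

-- Majority dominator coloring with exactly k (nonempty) color classes of a
-- graph on Fin m with adjacency `a`:  a proper colouring c, surjective onto
-- the k colours, such that every vertex v has a colour class C with
-- |N[v] ∩ C| ≥ |C| / 2  (stated as 2·|N[v] ∩ C| ≥ |C|).
IsMajorityDominatorColoring : ∀ {m} (a : Fin m → Fin m → Bool) (k : ℕ)
  → (Fin m → Fin k) → Set
IsMajorityDominatorColoring {m} a k c =
  (∀ u v → a u v ≡ true → c u ≢ c v)
  × Surjective _≡_ _≡_ c
  × (∀ v → ∃ λ (j : Fin k) →
        count (λ u → c u == j)
          ≤ 2 * count (λ u → ((u == v) ∨ a v u) ∧ (c u == j)))

HasMDColoring : ∀ {m} (a : Fin m → Fin m → Bool) (k : ℕ) → Set
HasMDColoring {m} a k = ∃ λ (c : Fin m → Fin k) → IsMajorityDominatorColoring a k c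

χmd≡ : ∀ {m} (a : Fin m → Fin m → Bool) (k : ℕ) → Set
χmd≡ a k = HasMDColoring a k × (∀ j → j < k → ¬ HasMDColoring a j)

module Submission where

-- A pendant p of G ∘ K₁ has closed neighbourhood {p, v} with p and v coloured
-- differently, so a colour class dominating p meets N[p] in a single vertex and
-- has at most two elements: every one of the n pairs {v, p} meets a class of size
-- at most 2.  These small classes contain at least n vertices, so there are at
-- least ⌈n/2⌉ of them, plus at least one more unless all classes are small, which
-- already forces n (and 2) colours.  Conversely, split the pairs into ⌈n/2⌉ groups
-- of at most two and give one vertex of each pair its group's colour and the other
-- a single shared colour; choosing which one by the side of the bipartition keeps
-- the shared class independent, and every closed neighbourhood contains a whole
-- pair, hence a vertex of a class of size at most 2.

open import Defs hiding (sym)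
open import Data.Bool using (Bool; true; false; not; _∧_; _∨_; _xor_)
open import Data.Bool.Properties using (∨-zeroʳ; ∧-conicalˡ; ∧-conicalʳ; xor-same; not-¬; not-distribˡ-xor)
open import Data.Empty using (⊥-elim)
open import Data.Fin using (Fin; zero; suc; _↑ˡ_; _↑ʳ_; splitAt; _≟_)
open import Data.Fin.Properties
  using (suc-injective; ↑ˡ-injective; splitAt-↑ˡ; splitAt-↑ʳ; splitAt⁻¹-↑ˡ; splitAt⁻¹-↑ʳ)
open import Data.Nat using (ℕ; zero; suc; _+_; _*_; _≤_; _<_; _≥_; z≤n; s≤s; s≤s⁻¹; _≤?_; ⌈_/2⌉)
open import Data.Nat.Properties
  using ( ≤-refl; ≤-trans; ≤-reflexive; <⇒≱; +-mono-≤; +-comm; +-assoc; +-suc; +-identityʳ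
        ; *-zeroʳ; *-identityʳ; *-monoʳ-≤; *-cancelˡ-≤; m≤n⇒m≤1+n; m≤n+m; ⌈n/2⌉<n
        ; +-*-semiring; module ≤-Reasoning)
open import Data.Product using (∃; ∃₂; _×_; _,_; proj₁; proj₂)
open import Data.Sum using (_⊎_; inj₁; inj₂)
open import Function using (_∘_)
open import Function.Definitions using (Surjective)
open import Relation.Nullary using (yes; no)
open import Relation.Nullary.Decidable using (⌊_⌋; isYes≗does)
open import Relation.Binary.PropositionalEquality

open import Algebra.Properties.Semiring.Sum +-*-semiring
  using (sum; sum-syntax; sum-cong-≗; sum-replicate-zero; ∑-comm; ∑-distrib-+; *-distribˡ-sum)

==-refl : ∀ {m} (i : Fin m) → (i == i) ≡ true
==-refl i with i ≟ i
... | yes _ = refl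
... | no i≢i = ⊥-elim (i≢i refl)

==⇒≡ : ∀ {m} {i j : Fin m} → (i == j) ≡ true → i ≡ j
==⇒≡ {i = i} {j} eq with i ≟ j
... | yes i≡j = i≡j

≢⇒==-false : ∀ {m} {i j : Fin m} → i ≢ j → (i == j) ≡ false
≢⇒==-false {i = i} {j} i≢j with i ≟ j
... | yes i≡j = ⊥-elim (i≢j i≡j)
... | no _ = refl

==-suc : ∀ {m} (i j : Fin m) → (Fin.suc i == suc j) ≡ (i == j)
==-suc i j = trans (isYes≗does (suc i ≟ suc j)) (sym (isYes≗does (i ≟ j)))

boolToℕ-mono : ∀ {a b : Bool} → (a ≡ true → b ≡ true) → boolToℕ a ≤ boolToℕ b
boolToℕ-mono {false} _ = z≤n
boolToℕ-mono {true} a⇒b rewrite a⇒b refl = ≤-refl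

boolToℕ-∨ : ∀ a b → boolToℕ (a ∨ b) ≤ boolToℕ a + boolToℕ b
boolToℕ-∨ true _ = s≤s z≤n
boolToℕ-∨ false _ = ≤-refl

∑-mono-≤ : ∀ {m} {f g : Fin m → ℕ} → (∀ i → f i ≤ g i) → sum f ≤ sum g
∑-mono-≤ {zero} _ = z≤n
∑-mono-≤ {suc m} f≤g = +-mono-≤ (f≤g zero) (∑-mono-≤ (f≤g ∘ suc))

∑-indicator : ∀ {k} (f : Fin k → ℕ) (x : Fin k) → (∑[ t < k ] (f t * boolToℕ (x == t))) ≡ f x
∑-indicator {suc k} f zero = trans (cong₂ _+_ (*-identityʳ (f zero)) rest≡0) (+-identityʳ (f zero))
  where
  rest≡0 : (∑[ t < k ] (f (suc t) * 0)) ≡ 0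
  rest≡0 = trans (sum-cong-≗ (λ t → *-zeroʳ (f (suc t)))) (sum-replicate-zero k)
∑-indicator {suc k} f (suc x) = cong₂ _+_ (*-zeroʳ (f zero)) (trans rest≡ (∑-indicator (f ∘ suc) x))
  where
  rest≡ : (∑[ t < k ] (f (suc t) * boolToℕ (suc x == suc t))) ≡ (∑[ t < k ] (f (suc t) * boolToℕ (x == t)))
  rest≡ = sum-cong-≗ (λ t → cong (λ b → f (suc t) * boolToℕ b) (==-suc x t))

count≡∑ : ∀ {m} (p : Fin m → Bool) → count p ≡ (∑[ i < m ] boolToℕ (p i))
count≡∑ {zero} _ = refl
count≡∑ {suc m} p = cong (boolToℕ (p zero) +_) (count≡∑ (p ∘ suc))

count-cong : ∀ {m} {p q : Fin m → Bool} → (∀ i → p i ≡ q i) → count p ≡ count q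
count-cong {zero} _ = refl
count-cong {suc m} p≗q = cong₂ _+_ (cong boolToℕ (p≗q zero)) (count-cong (p≗q ∘ suc))

count≤size : ∀ {m} (p : Fin m → Bool) → count p ≤ m
count≤size {zero} _ = z≤n
count≤size {suc m} p with p zero
... | true = s≤s (count≤size (p ∘ suc))
... | false = m≤n⇒m≤1+n (count≤size (p ∘ suc))

count-all : ∀ {m} (p : Fin m → Bool) → (∀ i → p i ≡ true) → count p ≡ m
count-all {zero} _ _ = refl
count-all {suc m} p all rewrite all zero = cong suc (count-all (p ∘ suc) (all ∘ suc))

count<size⊎all : ∀ {m} (p : Fin m → Bool) → count p < m ⊎ (∀ i → p i ≡ true)
count<size⊎all {zero} _ = inj₂ λ ()
count<size⊎all {suc m} p with p zero in p0 | count<size⊎all (p ∘ suc)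
... | false | _ = inj₁ (s≤s (count≤size (p ∘ suc)))
... | true | inj₁ lt = inj₁ (s≤s lt)
... | true | inj₂ all = inj₂ λ { zero → p0 ; (suc i) → all i }

count-none : ∀ {m} (p : Fin m → Bool) → (∀ i → p i ≡ false) → count p ≡ 0
count-none {zero} _ _ = refl
count-none {suc m} p none rewrite none zero = count-none (p ∘ suc) (none ∘ suc)

count-pos : ∀ {m} (p : Fin m → Bool) {i : Fin m} → p i ≡ true → 1 ≤ count p
count-pos {suc m} p {zero} pi rewrite pi = s≤s z≤n
count-pos {suc m} p {suc i} pi = ≤-trans (count-pos (p ∘ suc) pi) (m≤n+m _ (boolToℕ (p zero)))

count-pos⇒∃ : ∀ {m} (p : Fin m → Bool) → 1 ≤ count p → ∃ λ i → p i ≡ true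
count-pos⇒∃ {suc m} p pos with p zero in p0
... | true = zero , p0
... | false with count-pos⇒∃ (p ∘ suc) pos
...   | i , pi = suc i , pi

count-subsingleton : ∀ {m} (p : Fin m → Bool) → (∀ i j → p i ≡ true → p j ≡ true → i ≡ j) → count p ≤ 1
count-subsingleton {zero} _ _ = z≤n
count-subsingleton {suc m} p unique with p zero in p0
... | false = count-subsingleton (p ∘ suc) (λ i j pi pj → suc-injective (unique (suc i) (suc j) pi pj))
... | true = s≤s (≤-reflexive (count-none (p ∘ suc) none))
  where
  none : ∀ i → p (suc i) ≡ false
  none i with p (suc i) in pi
  ... | false = refl
  ... | true with unique zero (suc i) p0 pi
  ...   | ()

count-↑ : ∀ m n (p : Fin (m + n) → Bool) → count p ≡ count (λ i → p (i ↑ˡ n)) + count (λ i → p (m ↑ʳ i))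
count-↑ zero n p = refl
count-↑ (suc m) n p =
  trans (cong (boolToℕ (p zero) +_) (count-↑ m n (p ∘ suc))) (sym (+-assoc (boolToℕ (p zero)) _ _))

count-+-≤ : ∀ {m} {p q r : Fin m → Bool} → (∀ i → boolToℕ (p i) + boolToℕ (q i) ≤ boolToℕ (r i))
  → count p + count q ≤ count r
count-+-≤ {m} {p} {q} {r} pointwise = begin
  count p + count q                                       ≡⟨ cong₂ _+_ (count≡∑ p) (count≡∑ q) ⟩
  (∑[ i < m ] boolToℕ (p i)) + (∑[ i < m ] boolToℕ (q i)) ≡⟨ ∑-distrib-+ (boolToℕ ∘ p) (boolToℕ ∘ q) ⟨
  (∑[ i < m ] (boolToℕ (p i) + boolToℕ (q i)))            ≤⟨ ∑-mono-≤ pointwise ⟩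
  (∑[ i < m ] boolToℕ (r i))                              ≡⟨ count≡∑ r ⟨
  count r                                                 ∎
  where open ≤-Reasoning

count-∨-≤ : ∀ {m} (p q : Fin m → Bool) → count (λ i → p i ∨ q i) ≤ count p + count q
count-∨-≤ {m} p q = begin
  count (λ i → p i ∨ q i)                                 ≡⟨ count≡∑ (λ i → p i ∨ q i) ⟩
  (∑[ i < m ] boolToℕ (p i ∨ q i))                        ≤⟨ ∑-mono-≤ (λ i → boolToℕ-∨ (p i) (q i)) ⟩
  (∑[ i < m ] (boolToℕ (p i) + boolToℕ (q i)))            ≡⟨ ∑-distrib-+ (boolToℕ ∘ p) (boolToℕ ∘ q) ⟩
  (∑[ i < m ] boolToℕ (p i)) + (∑[ i < m ] boolToℕ (q i)) ≡⟨ cong₂ _+_ (count≡∑ p) (count≡∑ q) ⟨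
  count p + count q                                       ∎
  where open ≤-Reasoning

classSize : ∀ {m k} → (Fin m → Fin k) → Fin k → ℕ
classSize c t = count (λ u → c u == t)

count-∘-≤ : ∀ {m k} (c : Fin m → Fin k) (s : Fin k → Bool) (b : ℕ)
  → (∀ t → s t ≡ true → classSize c t ≤ b) → count (s ∘ c) ≤ b * count s
count-∘-≤ {m} {k} c s b class≤b = begin
  count (s ∘ c)                                ≡⟨ count≡∑ (s ∘ c) ⟩
  (∑[ u < m ] boolToℕ (s (c u)))               ≡⟨ sum-cong-≗ (λ u → ∑-indicator (boolToℕ ∘ s) (c u)) ⟨
  (∑[ u < m ] (∑[ t < k ] weight u t))         ≡⟨ ∑-comm weight ⟩
  (∑[ t < k ] (∑[ u < m ] weight u t))         ≡⟨ sum-cong-≗ weightedClassSize ⟨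
  (∑[ t < k ] (boolToℕ (s t) * classSize c t)) ≤⟨ ∑-mono-≤ weightedClassSize≤ ⟩
  (∑[ t < k ] (b * boolToℕ (s t)))             ≡⟨ *-distribˡ-sum b (boolToℕ ∘ s) ⟨
  b * (∑[ t < k ] boolToℕ (s t))               ≡⟨ cong (b *_) (count≡∑ s) ⟨
  b * count s                                  ∎
  where
  open ≤-Reasoning

  weight : Fin m → Fin k → ℕ
  weight u t = boolToℕ (s t) * boolToℕ (c u == t)

  weightedClassSize : ∀ t → boolToℕ (s t) * classSize c t ≡ (∑[ u < m ] weight u t)
  weightedClassSize t =
    trans (cong (boolToℕ (s t) *_) (count≡∑ (λ u → c u == t)))
          (*-distribˡ-sum (boolToℕ (s t)) (λ u → boolToℕ (c u == t)))

  weightedClassSize≤ : ∀ t → boolToℕ (s t) * classSize c t ≤ b * boolToℕ (s t)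
  weightedClassSize≤ t with s t in st
  ... | false = z≤n
  ... | true = ≤-trans (≤-reflexive (+-identityʳ _)) (≤-trans (class≤b t st) (≤-reflexive (sym (*-identityʳ b))))

closedNbhd : ∀ {m} → (Fin m → Fin m → Bool) → Fin m → Fin m → Bool
closedNbhd a v u = (u == v) ∨ a v u

isSmallClass : ∀ {m k} → (Fin m → Fin k) → Fin k → Bool
isSmallClass c t = ⌊ classSize c t ≤? 2 ⌋

isSmallClass⇒≤2 : ∀ {m k} (c : Fin m → Fin k) t → isSmallClass c t ≡ true → classSize c t ≤ 2
isSmallClass⇒≤2 c t small with classSize c t ≤? 2
... | yes ≤2 = ≤2

≤2⇒isSmallClass : ∀ {m k} (c : Fin m → Fin k) t → classSize c t ≤ 2 → isSmallClass c t ≡ true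
≤2⇒isSmallClass c t ≤2 with classSize c t ≤? 2
... | yes _ = refl
... | no ≰2 = ⊥-elim (≰2 ≤2)

classSize-pos : ∀ {m k} (c : Fin m → Fin k) → Surjective _≡_ _≡_ c → ∀ t → 1 ≤ classSize c t
classSize-pos c surj t with surj t
... | u , cu≡t = count-pos (λ w → c w == t) (subst (λ t′ → (c u == t′) ≡ true) (cu≡t refl) (==-refl (c u)))

isMDColoring-bySmallClasses : ∀ {m k} (a : Fin m → Fin m → Bool) (c : Fin m → Fin k)
  → (∀ u v → a u v ≡ true → c u ≢ c v) → Surjective _≡_ _≡_ c
  → (∀ v → ∃ λ w → closedNbhd a v w ≡ true × classSize c (c w) ≤ 2)
  → IsMajorityDominatorColoring a k c
isMDColoring-bySmallClasses a c proper surj dominated = proper , surj , dominating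
  where
  dominating : ∀ v → ∃ λ t → classSize c t ≤ 2 * count (λ u → closedNbhd a v u ∧ (c u == t))
  dominating v with dominated v
  ... | w , near , small = c w , ≤-trans small (*-monoʳ-≤ 2 (count-pos (λ u → closedNbhd a v u ∧ (c u == c w)) w∈))
    where
    w∈ : (closedNbhd a v w ∧ (c w == c w)) ≡ true
    w∈ = cong₂ _∧_ near (==-refl (c w))

1≤2*n⇒1≤n : ∀ {n} → 1 ≤ 2 * n → 1 ≤ n
1≤2*n⇒1≤n {suc _} _ = s≤s z≤n

pendant-meets-smallClass : ∀ {m k} {a : Fin m → Fin m → Bool} {c : Fin m → Fin k}
  → IsMajorityDominatorColoring a k c
  → ∀ {p v} → a p v ≡ true → (∀ u → a p u ≡ true → u ≡ v)
  → (isSmallClass c (c p) ∨ isSmallClass c (c v)) ≡ true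
pendant-meets-smallClass {a = a} {c} (proper , surj , md) {p} {v} edge onlyNeighbour =
  meets (count-pos⇒∃ inClass (1≤2*n⇒1≤n (≤-trans (classSize-pos c surj t) dominated)))
  where
  t : Fin _
  t = proj₁ (md p)

  dominated : classSize c t ≤ 2 * count (λ u → closedNbhd a p u ∧ (c u == t))
  dominated = proj₂ (md p)

  inClass : Fin _ → Bool
  inClass u = closedNbhd a p u ∧ (c u == t)

  inPair : ∀ u → inClass u ≡ true → u ≡ p ⊎ u ≡ v
  inPair u inU with u == p in u==p
  ... | true = inj₁ (==⇒≡ u==p)
  ... | false = inj₂ (onlyNeighbour u (∧-conicalˡ _ _ inU))

  color≡t : ∀ u → inClass u ≡ true → c u ≡ t
  color≡t u inU = ==⇒≡ (∧-conicalʳ _ _ inU)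

  unique : ∀ u w → inClass u ≡ true → inClass w ≡ true → u ≡ w
  unique u w inU inW with inPair u inU | inPair w inW
  ... | inj₁ refl | inj₁ refl = refl
  ... | inj₂ refl | inj₂ refl = refl
  ... | inj₁ refl | inj₂ refl = ⊥-elim (proper p v edge (trans (color≡t u inU) (sym (color≡t w inW))))
  ... | inj₂ refl | inj₁ refl = ⊥-elim (proper p v edge (trans (color≡t w inW) (sym (color≡t u inU))))

  small : isSmallClass c t ≡ true
  small = ≤2⇒isSmallClass c t (≤-trans dominated (*-monoʳ-≤ 2 (count-subsingleton inClass unique)))

  meets : (∃ λ u → inClass u ≡ true) → (isSmallClass c (c p) ∨ isSmallClass c (c v)) ≡ true
  meets (u , inU) with inPair u inU
  ... | inj₁ refl rewrite color≡t u inU | small = refl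
  ... | inj₂ refl rewrite color≡t u inU | small = ∨-zeroʳ _

twoColors : ∀ {m k} {a : Fin m → Fin m → Bool} {c : Fin m → Fin k}
  → IsMajorityDominatorColoring a k c → ∀ {u v} → a u v ≡ true → 2 ≤ k
twoColors {k = zero} {c = c} _ {u} _ with c u
... | ()
twoColors {k = suc zero} {c = c} (proper , _) {u} {v} edge with c u in cu | c v in cv
... | zero | zero = ⊥-elim (proper u v edge (trans cu (sym cv)))
twoColors {k = suc (suc _)} _ _ = s≤s (s≤s z≤n)

n≤2*m⇒⌈n/2⌉≤m : ∀ n m → n ≤ 2 * m → ⌈ n /2⌉ ≤ m
n≤2*m⇒⌈n/2⌉≤m zero m _ = z≤n
n≤2*m⇒⌈n/2⌉≤m (suc zero) (suc m) _ = s≤s z≤n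
n≤2*m⇒⌈n/2⌉≤m (suc (suc n)) (suc m) n≤2m =
  s≤s (n≤2*m⇒⌈n/2⌉≤m n m (s≤s⁻¹ (subst (suc n ≤_) (+-suc m (m + 0)) (s≤s⁻¹ n≤2m))))

⌈n/2⌉+1≤ : ∀ n {k} → n ≤ k → 2 ≤ k → ⌈ n /2⌉ + 1 ≤ k
⌈n/2⌉+1≤ zero _ 2≤k = ≤-trans (s≤s z≤n) 2≤k
⌈n/2⌉+1≤ (suc zero) _ 2≤k = 2≤k
⌈n/2⌉+1≤ (suc (suc n)) n≤k _ =
  ≤-trans (≤-reflexive (+-comm ⌈ suc (suc n) /2⌉ 1)) (≤-trans (⌈n/2⌉<n n) n≤k)

halve : ∀ {n} → Fin n → Fin ⌈ n /2⌉
halve {suc zero} zero = zero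
halve {suc (suc n)} zero = zero
halve {suc (suc n)} (suc zero) = zero
halve {suc (suc n)} (suc (suc i)) = suc (halve i)

twice : ∀ {n} → Fin ⌈ n /2⌉ → Fin n
twice {suc zero} zero = zero
twice {suc (suc n)} zero = zero
twice {suc (suc n)} (suc t) = suc (suc (twice t))

halve-twice : ∀ {n} (t : Fin ⌈ n /2⌉) → halve {n} (twice t) ≡ t
halve-twice {suc zero} zero = refl
halve-twice {suc (suc n)} zero = refl
halve-twice {suc (suc n)} (suc t) = cong suc (halve-twice {n} t)

halve-fibre≤2 : ∀ {n} (t : Fin ⌈ n /2⌉) → count (λ i → halve {n} i == t) ≤ 2
halve-fibre≤2 {suc zero} t = ≤-trans (count≤size (λ i → halve i == t)) (s≤s z≤n)
halve-fibre≤2 {suc (suc n)} zero =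
  ≤-reflexive (cong (2 +_) (count-none {n} (λ i → suc (halve i) == zero) (λ _ → refl)))
halve-fibre≤2 {suc (suc n)} (suc t) =
  ≤-trans (≤-reflexive (count-cong (λ i → ==-suc (halve i) t))) (halve-fibre≤2 {n} t)

module Corona {n} (G : SimpleGraph n) where

  vertex pendant : Fin n → Fin (n + n)
  vertex i = i ↑ˡ n
  pendant i = n ↑ʳ i

  vertex-pendant : ∀ i → coronaAdj G (vertex i) (pendant i) ≡ true
  vertex-pendant i rewrite splitAt-↑ˡ n i n | splitAt-↑ʳ n n i = ==-refl i

  pendant-vertex : ∀ i → coronaAdj G (pendant i) (vertex i) ≡ true
  pendant-vertex i rewrite splitAt-↑ˡ n i n | splitAt-↑ʳ n n i = ==-refl i

  pendant-onlyNeighbour : ∀ i u → coronaAdj G (pendant i) u ≡ true → u ≡ vertex i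
  pendant-onlyNeighbour i u adj rewrite splitAt-↑ʳ n n i with splitAt n u in eq
  ... | inj₁ j = trans (sym (splitAt⁻¹-↑ˡ eq)) (cong (_↑ˡ n) (sym (==⇒≡ adj)))

  count-corona : (p : Fin (n + n) → Bool) → count p ≡ count (p ∘ vertex) + count (p ∘ pendant)
  count-corona = count-↑ n n

  module _ {k} {c : Fin (n + n) → Fin k} (md : IsMajorityDominatorColoring (coronaAdj G) k c) where

    private
      small : Fin k → Bool
      small = isSmallClass c

    smallClassVertices≤ : count (small ∘ c) ≤ 2 * count small
    smallClassVertices≤ = count-∘-≤ c small 2 (isSmallClass⇒≤2 c)

    n≤smallClassVertices : n ≤ count (small ∘ c)
    n≤smallClassVertices = begin
      n
        ≡⟨ count-all eitherSmall pairMeetsSmall ⟨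
      count eitherSmall
        ≤⟨ count-∨-≤ (small ∘ c ∘ pendant) (small ∘ c ∘ vertex) ⟩
      count (small ∘ c ∘ pendant) + count (small ∘ c ∘ vertex)
        ≡⟨ +-comm (count (small ∘ c ∘ pendant)) _ ⟩
      count (small ∘ c ∘ vertex) + count (small ∘ c ∘ pendant)
        ≡⟨ count-corona (small ∘ c) ⟨
      count (small ∘ c) ∎
      where
      open ≤-Reasoning
      eitherSmall : Fin n → Bool
      eitherSmall i = small (c (pendant i)) ∨ small (c (vertex i))
      pairMeetsSmall : ∀ i → eitherSmall i ≡ true
      pairMeetsSmall i = pendant-meets-smallClass md (pendant-vertex i) (pendant-onlyNeighbour i)

    colors-lower : Fin n → ⌈ n /2⌉ + 1 ≤ k
    colors-lower i₀ with count<size⊎all small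
    ... | inj₁ fewSmall = begin
      ⌈ n /2⌉ + 1          ≡⟨ +-comm ⌈ n /2⌉ 1 ⟩
      suc ⌈ n /2⌉          ≤⟨ s≤s (n≤2*m⇒⌈n/2⌉≤m n _ n≤2*small) ⟩
      suc (count small)    ≤⟨ fewSmall ⟩
      k                    ∎
      where
      open ≤-Reasoning
      n≤2*small : n ≤ 2 * count small
      n≤2*small = ≤-trans n≤smallClassVertices smallClassVertices≤
    ... | inj₂ allSmall = ⌈n/2⌉+1≤ n n≤k (twoColors md (pendant-vertex i₀))
      where
      n≤k : n ≤ k
      n≤k = *-cancelˡ-≤ 2 (begin
        2 * n                ≡⟨ cong (n +_) (+-identityʳ n) ⟩
        n + n                ≡⟨ count-all (small ∘ c) (allSmall ∘ c) ⟨
        count (small ∘ c)    ≤⟨ smallClassVertices≤ ⟩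
        2 * count small      ≤⟨ *-monoʳ-≤ 2 (count≤size small) ⟩
        2 * k                ∎)
        where open ≤-Reasoning

  member : Bool → Fin n → Fin (n + n)
  member false = vertex
  member true = pendant

  pairView : ∀ u → ∃₂ λ b i → u ≡ member b i
  pairView u with splitAt n u in eq
  ... | inj₁ i = false , i , sym (splitAt⁻¹-↑ˡ eq)
  ... | inj₂ i = true , i , sym (splitAt⁻¹-↑ʳ eq)

  samePair-closedNbhd : ∀ b b′ i → closedNbhd (coronaAdj G) (member b i) (member b′ i) ≡ true
  samePair-closedNbhd false false i rewrite ==-refl (vertex i) = refl
  samePair-closedNbhd true true i rewrite ==-refl (pendant i) = refl
  samePair-closedNbhd false true i rewrite vertex-pendant i = ∨-zeroʳ _
  samePair-closedNbhd true false i rewrite pendant-vertex i = ∨-zeroʳ _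

  module Coloring (side : Fin n → Bool) (bipartite : ∀ u v → adj G u v ≡ true → side u ≢ side v) where

    Color : Set
    Color = Fin (⌈ n /2⌉ + 1)

    pairColor : Fin ⌈ n /2⌉ → Color
    pairColor t = t ↑ˡ 1

    sharedColor : Color
    sharedColor = ⌈ n /2⌉ ↑ʳ zero

    sharedColor≢pairColor : ∀ t → sharedColor ≢ pairColor t
    sharedColor≢pairColor t eq
      with trans (sym (splitAt-↑ʳ ⌈ n /2⌉ 1 zero)) (trans (cong (splitAt ⌈ n /2⌉) eq) (splitAt-↑ˡ ⌈ n /2⌉ t 1))
    ... | ()

    colorBy : Bool → Fin n → Color
    colorBy true _ = sharedColor
    colorBy false i = pairColor (halve i)

    colorBy-≢ : ∀ b b′ {i j} → b ≢ b′ → colorBy b i ≢ colorBy b′ j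
    colorBy-≢ true true b≢b′ = ⊥-elim (b≢b′ refl)
    colorBy-≢ false false b≢b′ = ⊥-elim (b≢b′ refl)
    colorBy-≢ true false {j = j} _ = sharedColor≢pairColor (halve j)
    colorBy-≢ false true {i} _ = sharedColor≢pairColor (halve i) ∘ sym

    color⊎ : Fin n ⊎ Fin n → Color
    color⊎ (inj₁ i) = colorBy (side i) i
    color⊎ (inj₂ i) = colorBy (not (side i)) i

    color : Fin (n + n) → Color
    color u = color⊎ (splitAt n u)

    color-member : ∀ b i → color (member b i) ≡ colorBy (b xor side i) i
    color-member false i = cong color⊎ (splitAt-↑ˡ n i n)
    color-member true i = cong color⊎ (splitAt-↑ʳ n n i)

    color-proper : ∀ u w → coronaAdj G u w ≡ true → color u ≢ color w
    color-proper u w = proper (splitAt n u) (splitAt n w)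
      where
      proper : ∀ x y → coronaAdj' G x y ≡ true → color⊎ x ≢ color⊎ y
      proper (inj₁ i) (inj₁ j) adj = colorBy-≢ (side i) (side j) (bipartite i j adj)
      proper (inj₁ i) (inj₂ j) adj with ==⇒≡ adj
      ... | refl = colorBy-≢ (side i) (not (side i)) (not-¬ refl)
      proper (inj₂ i) (inj₁ j) adj with ==⇒≡ adj
      ... | refl = colorBy-≢ (not (side i)) (side i) (not-¬ refl ∘ sym)

    pairMember-color : ∀ i → color (member (side i) i) ≡ pairColor (halve i)
    pairMember-color i = trans (color-member (side i) i) (cong (λ b → colorBy b i) (xor-same (side i)))

    sharedMember-color : ∀ i → color (member (not (side i)) i) ≡ sharedColor
    sharedMember-color i = trans (color-member (not (side i)) i) (cong (λ b → colorBy b i) not-x-xor-x)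
      where
      not-x-xor-x : not (side i) xor side i ≡ true
      not-x-xor-x = trans (sym (not-distribˡ-xor (side i) (side i))) (cong not (xor-same (side i)))

    pairColor-==⇒ : ∀ i t → (pairColor (halve i) == pairColor t) ≡ true → (halve i == t) ≡ true
    pairColor-==⇒ i t eq rewrite ↑ˡ-injective 1 (halve i) t (==⇒≡ eq) = ==-refl t

    colorBy-pair : ∀ b i t
      → boolToℕ (colorBy b i == pairColor t) + boolToℕ (colorBy (not b) i == pairColor t) ≤ boolToℕ (halve i == t)
    colorBy-pair false i t
      rewrite ≢⇒==-false (sharedColor≢pairColor t) | +-identityʳ (boolToℕ (pairColor (halve i) == pairColor t)) =
      boolToℕ-mono (pairColor-==⇒ i t)
    colorBy-pair true i t rewrite ≢⇒==-false (sharedColor≢pairColor t) = boolToℕ-mono (pairColor-==⇒ i t)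

    pairColorClass≤2 : ∀ t → classSize color (pairColor t) ≤ 2
    pairColorClass≤2 t = begin
      classSize color (pairColor t)                                     ≡⟨ count-corona (λ u → color u == pairColor t) ⟩
      count (λ i → [ color (vertex i) ]≡t) + count (λ i → [ color (pendant i) ]≡t) ≤⟨ count-+-≤ pointwise ⟩
      count (λ i → halve i == t)                                        ≤⟨ halve-fibre≤2 t ⟩
      2                                                                 ∎
      where
      open ≤-Reasoning
      [_]≡t : Color → Bool
      [ x ]≡t = x == pairColor t
      pointwise : ∀ i → boolToℕ [ color (vertex i) ]≡t + boolToℕ [ color (pendant i) ]≡t ≤ boolToℕ (halve i == t)
      pointwise i = begin
        boolToℕ [ color (vertex i) ]≡t + boolToℕ [ color (pendant i) ]≡t
          ≡⟨ cong₂ (λ x y → boolToℕ [ x ]≡t + boolToℕ [ y ]≡t) (color-member false i) (color-member true i) ⟩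
        boolToℕ [ colorBy (side i) i ]≡t + boolToℕ [ colorBy (not (side i)) i ]≡t
          ≤⟨ colorBy-pair (side i) i t ⟩
        boolToℕ (halve i == t) ∎

    color-surjective : Fin n → Surjective _≡_ _≡_ color
    color-surjective i₀ y with splitAt ⌈ n /2⌉ y in eq
    ... | inj₁ t = member (side (twice t)) (twice t) , λ { refl →
      trans (pairMember-color (twice t)) (trans (cong pairColor (halve-twice t)) (splitAt⁻¹-↑ˡ eq)) }
    ... | inj₂ zero = member (not (side i₀)) i₀ , λ { refl → trans (sharedMember-color i₀) (splitAt⁻¹-↑ʳ eq) }

    color-dominated : ∀ v → ∃ λ w → closedNbhd (coronaAdj G) v w ≡ true × classSize color (color w) ≤ 2
    color-dominated v with pairView v
    ... | b , i , refl = member (side i) i , samePair-closedNbhd b (side i) i ,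
      subst (λ x → classSize color x ≤ 2) (sym (pairMember-color i)) (pairColorClass≤2 (halve i))

    hasMDColoring : Fin n → HasMDColoring (coronaAdj G) (⌈ n /2⌉ + 1)
    hasMDColoring i₀ =
      color , isMDColoring-bySmallClasses (coronaAdj G) color color-proper (color-surjective i₀) color-dominated

mainTheorem19 : (n : ℕ) → n ≥ 1 → (G : SimpleGraph n) → IsBipartite G
    → χmd≡ (coronaAdj G) (⌈ n /2⌉ + 1)
mainTheorem19 (suc n) _ G (side , bipartite) =
  Coloring.hasMDColoring side bipartite zero , λ k k<bound (c , md) → <⇒≱ k<bound (colors-lower md zero)
  where open Corona G
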